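{- Let $D$ be a finite connected digraph with $\chi(D)=5$, not isomorphic to $T_5$, in which every vertex has out-degree at least $2$, such that $D$ contains no copy of $p_4$ and the underlying graph of $D$ contains no $K_5$. Let $D'$ be a $5$-critical subdigraph of $D$ and let $D^o$ be the subdigraph of $D'$ induced by the vertices whose out-degree in $D'$ is at least $3$. Then every vertex of $D$ has at most one in-neighbor in $D^o$.
   Context: A digraph has no loops and, for any two vertices $x,y$, at most one of the arcs $(x,y),(y,x)$; $\chi$ is the chromatic number of the underlying (unoriented) graph. $T_5$ is the $5$-vertex tournament in which every vertex has in- and out-degree $2$. $p_4$ is the digraph with vertices $x,y,z,v,w$ and arcs $y\to x$, $y\to z$, $v\to z$, $v\to w$; a copy of $H$ in $D$ is the image of an injective arc-preserving map $V(H)\to V(D)$. A subdigraph $D'$ is $5$-critical if $\chi(D')=5$ and $\chi(D'-u)<5$ for every vertex $u$ of $D'$. -}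

module Defs where

open import Data.Nat using (ℕ; zero; suc; _≤_; _≤ᵇ_; _%_; _+_)
open import Data.Nat.Properties using () renaming (_≟_ to _≟ℕ_)
open import Data.Fin using (Fin; toℕ)
open import Data.Fin.Subset using (∣_∣)
open import Data.Vec using (tabulate)
open import Data.Bool using (Bool; true; false; _∧_; _∨_)
open import Data.Product using (Σ; Σ-syntax; _×_)
open import Relation.Nullary using (¬_)
open import Relation.Nullary.Decidable using (⌊_⌋)
open import Relation.Binary.PropositionalEquality using (_≡_; _≢_)
open import Function.Bundles using (_↔_; Inverse)
open import Function.Definitions using (Injective)

record Digraph (n : ℕ) : Set where
  field
    arc      : Fin n → Fin n → Bool
    loopless : ∀ x → arc x x ≡ false
    asym     : ∀ x y → arc x y ≡ true → arc y x ≡ false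
open Digraph public

adj : ∀ {n} → Digraph n → Fin n → Fin n → Bool
adj D x y = arc D x y ∨ arc D y x

count : ∀ {n} → (Fin n → Bool) → ℕ
count p = ∣ tabulate p ∣

outdeg : ∀ {n} → Digraph n → Fin n → ℕ
outdeg D x = count (arc D x)

data Reach {n} (D : Digraph n) : Fin n → Fin n → Set where
  here : ∀ {x} → Reach D x x
  step : ∀ {x y z} → adj D x y ≡ true → Reach D y z → Reach D x z

Connected : ∀ {n} → Digraph n → Set
Connected D = ∀ x y → Reach D x y

Colorable : ∀ {n} → (Fin n → Fin n → Set) → ℕ → Set
Colorable {n} E k = Σ[ c ∈ (Fin n → Fin k) ] (∀ x y → E x y → c x ≢ c y)

ChiEq5 : ∀ {n} → Digraph n → Set
ChiEq5 D = Colorable (λ x y → arc D x y ≡ true) 5 × ¬ Colorable (λ x y → arc D x y ≡ true) 4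

T5arc : Fin 5 → Fin 5 → Bool
T5arc i j = ⌊ toℕ j ≟ℕ ((toℕ i + 1) % 5) ⌋ ∨ ⌊ toℕ j ≟ℕ ((toℕ i + 2) % 5) ⌋

IsoT5 : ∀ {n} → Digraph n → Set
IsoT5 {n} D = Σ[ f ∈ (Fin n ↔ Fin 5) ]
  (∀ x y → arc D x y ≡ T5arc (Inverse.to f x) (Inverse.to f y))

-- p4 on vertices x,y,z,v,w = 0,1,2,3,4 with arcs y→x, y→z, v→z, v→w
HasP4 : ∀ {n} → Digraph n → Set
HasP4 {n} D = Σ[ f ∈ (Fin 5 → Fin n) ] (Injective _≡_ _≡_ f ×
  (arc D (f (Fin.suc Fin.zero)) (f Fin.zero) ≡ true ×
   arc D (f (Fin.suc Fin.zero)) (f (Fin.suc (Fin.suc Fin.zero))) ≡ true ×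
   arc D (f (Fin.suc (Fin.suc (Fin.suc Fin.zero)))) (f (Fin.suc (Fin.suc Fin.zero))) ≡ true ×
   arc D (f (Fin.suc (Fin.suc (Fin.suc Fin.zero)))) (f (Fin.suc (Fin.suc (Fin.suc (Fin.suc Fin.zero))))) ≡ true))

HasK5 : ∀ {n} → Digraph n → Set
HasK5 {n} D = Σ[ f ∈ (Fin 5 → Fin n) ] (Injective _≡_ _≡_ f ×
  (∀ i j → i ≢ j → adj D (f i) (f j) ≡ true))

record Subdigraph {n} (D : Digraph n) : Set where
  field
    inV  : Fin n → Bool
    sarc : Fin n → Fin n → Bool
    sub  : ∀ x y → sarc x y ≡ true → (arc D x y ≡ true × inV x ≡ true × inV y ≡ true)
open Subdigraph public

Critical5 : ∀ {n} {D : Digraph n} → Subdigraph D → Set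
Critical5 {n} S =
  Colorable (λ x y → sarc S x y ≡ true) 5 ×
  ¬ Colorable (λ x y → sarc S x y ≡ true) 4 ×
  (∀ u → inV S u ≡ true →
     Colorable (λ x y → sarc S x y ≡ true × x ≢ u × y ≢ u) 4)

soutdeg : ∀ {n} {D : Digraph n} → Subdigraph D → Fin n → ℕ
soutdeg S x = count (sarc S x)

inDo : ∀ {n} {D : Digraph n} → Subdigraph D → Fin n → Bool
inDo S u = inV S u ∧ (3 ≤ᵇ soutdeg S u)

inNbrsInDo : ∀ {n} {D : Digraph n} → Subdigraph D → Fin n → ℕ
inNbrsInDo {D = D} S v = count (λ u → inDo S u ∧ arc D u v)

-- If u₁ ≠ u₂ both have out-degree at least 3 and a common out-neighbour z, orient the pair
-- so that there is no arc u₂ → u₁, pick x ∈ N⁺(u₁) ∖ {z, u₂} and then w ∈ N⁺(u₂) ∖ {z, x}: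
-- the five vertices x, u₁, z, u₂, w are distinct and carry u₁ → x, u₁ → z, u₂ → z, u₂ → w.
module Submission where

open import Defs
open import Data.Nat using (ℕ; zero; suc; _≤_; _<_; _+_; z≤n; s≤s; _≤?_)
open import Data.Nat.Properties
  using (≤-trans; ≤-reflexive; m≤n⇒m≤1+n; n≤1+n; +-suc; +-monoʳ-≤; +-mono-≤; ≰⇒>; ≤ᵇ⇒≤; <⇒≱)
open import Data.Fin using (Fin; zero; suc; _≟_)
open import Data.Fin.Properties using (suc-injective; any?)
open import Data.Bool using (Bool; true; false; _∧_; _∨_)
open import Data.Bool.Properties
  using (T-≡; ∧-conicalˡ; ∧-conicalʳ; ∨-conicalˡ; ∨-conicalʳ) renaming (_≟_ to _≟ᴮ_)
open import Data.Vec using ([]; _∷_; lookup)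
open import Data.Vec.Relation.Unary.All using ([]; _∷_)
open import Data.Vec.Relation.Unary.AllPairs using ([]; _∷_)
open import Data.Vec.Relation.Unary.Unique.Propositional using (Unique)
open import Data.Vec.Relation.Unary.Unique.Propositional.Properties using (lookup-injective)
open import Data.Product using (∃; ∃₂; _×_; _,_; proj₁)
open import Data.Empty using (⊥-elim)
open import Function using (_∘_; Equivalence)
open import Relation.Nullary using (¬_; yes; no; _×-dec_)
open import Relation.Nullary.Decidable using (⌊_⌋; toWitness)
open import Relation.Binary.PropositionalEquality using (_≡_; _≢_; refl; sym; trans; subst; ≢-sym)

count-mono : ∀ {n} {p q : Fin n → Bool} →
  (∀ x → p x ≡ true → q x ≡ true) → count p ≤ count q
count-mono {zero} _ = z≤n
count-mono {suc n} {p} {q} p⇒q with p zero in p₀ | q zero in q₀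
... | true  | true  = s≤s (count-mono (p⇒q ∘ suc))
... | true  | false with () ← trans (sym (p⇒q zero p₀)) q₀
... | false | true  = m≤n⇒m≤1+n (count-mono (p⇒q ∘ suc))
... | false | false = count-mono (p⇒q ∘ suc)

count-∨ : ∀ {n} (p q : Fin n → Bool) → count (λ x → p x ∨ q x) ≤ count p + count q
count-∨ {zero} p q = z≤n
count-∨ {suc n} p q with p zero | q zero | count-∨ (p ∘ suc) (q ∘ suc)
... | true  | true  | ih = s≤s (≤-trans ih (+-monoʳ-≤ (count (p ∘ suc)) (n≤1+n _)))
... | true  | false | ih = s≤s ih
... | false | true  | ih = ≤-trans (s≤s ih) (≤-reflexive (sym (+-suc _ _)))
... | false | false | ih = ih

count-false : ∀ n → count {n} (λ _ → false) ≡ 0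
count-false zero    = refl
count-false (suc n) = count-false n

count-≤1 : ∀ {n} {p : Fin n → Bool} →
  (∀ {x y} → p x ≡ true → p y ≡ true → x ≡ y) → count p ≤ 1
count-≤1 {zero} _ = z≤n
count-≤1 {suc n} {p} unique with p zero in p₀
... | true  = s≤s (≤-trans (count-mono only-zero) (≤-reflexive (count-false n)))
  where
  only-zero : ∀ x → p (suc x) ≡ true → false ≡ true
  only-zero x p₁ with () ← unique p₀ p₁
... | false = count-≤1 (λ p₁ p₂ → suc-injective (unique p₁ p₂))

∃-outside : ∀ {n} {p : Fin n → Bool} (bad : Fin n → Bool) →
  count bad < count p → ∃ λ x → p x ≡ true × bad x ≡ false
∃-outside {p = p} bad bad<p
  with any? (λ x → (p x ≟ᴮ true) ×-dec (bad x ≟ᴮ false))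
... | yes found = found
... | no ¬found = ⊥-elim (<⇒≱ bad<p (count-mono p⇒bad))
  where
  p⇒bad : ∀ x → p x ≡ true → bad x ≡ true
  p⇒bad x px with bad x in badx
  ... | true  = refl
  ... | false = ⊥-elim (¬found (x , px , badx))

count-≟ : ∀ {n} (a : Fin n) → count (λ x → ⌊ x ≟ a ⌋) ≤ 1
count-≟ a = count-≤1 λ {x} {y} x≡a y≡a →
  trans (toWitness {a? = x ≟ a} (Equivalence.from T-≡ x≡a))
        (sym (toWitness {a? = y ≟ a} (Equivalence.from T-≡ y≡a)))

≟-false⇒≢ : ∀ {n} {x a : Fin n} → ⌊ x ≟ a ⌋ ≡ false → x ≢ a
≟-false⇒≢ {x = x} {a} _ with x ≟ a
≟-false⇒≢ () | yes _
≟-false⇒≢ _  | no x≢a = x≢a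

∃-distinct-pair : ∀ {n} {p : Fin n → Bool} →
  2 ≤ count p → ∃₂ λ x y → x ≢ y × p x ≡ true × p y ≡ true
∃-distinct-pair {n} {p} 2≤p
  with ∃-outside (λ _ → false) (subst (_< count p) (sym (count-false n)) (≤-trans (s≤s z≤n) 2≤p))
... | x , px , _ with ∃-outside (λ y → ⌊ y ≟ x ⌋) (≤-trans (s≤s (count-≟ x)) 2≤p)
... | y , py , y≢ᵇx = x , y , ≢-sym (≟-false⇒≢ y≢ᵇx) , px , py

∃-avoiding₂ : ∀ {n} {p : Fin n → Bool} →
  3 ≤ count p → ∀ a b → ∃ λ x → p x ≡ true × x ≢ a × x ≢ b
∃-avoiding₂ 3≤p a b with ∃-outside (λ x → ⌊ x ≟ a ⌋ ∨ ⌊ x ≟ b ⌋) (≤-trans (s≤s ab≤2) 3≤p)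
  where
  ab≤2 : count (λ x → ⌊ x ≟ a ⌋ ∨ ⌊ x ≟ b ⌋) ≤ 2
  ab≤2 = ≤-trans (count-∨ (λ x → ⌊ x ≟ a ⌋) (λ x → ⌊ x ≟ b ⌋)) (+-mono-≤ (count-≟ a) (count-≟ b))
... | x , px , x∉ab =
  x , px , ≟-false⇒≢ (∨-conicalˡ _ _ x∉ab) , ≟-false⇒≢ (∨-conicalʳ _ _ x∉ab)

module _ {n : ℕ} (D : Digraph n) where

  arc⇒≢ : ∀ {x y} → arc D x y ≡ true → x ≢ y
  arc⇒≢ {x} x→y refl with () ← trans (sym x→y) (loopless D x)

  mkHasP4 : ∀ {x y z v w} → Unique (x ∷ y ∷ z ∷ v ∷ w ∷ []) →
    arc D y x ≡ true → arc D y z ≡ true → arc D v z ≡ true → arc D v w ≡ true → HasP4 D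
  mkHasP4 distinct y→x y→z v→z v→w =
    lookup (_ ∷ _ ∷ _ ∷ _ ∷ _ ∷ []) , (λ {i} {j} → lookup-injective distinct i j) ,
    y→x , y→z , v→z , v→w

  common-out-neighbour⇒HasP4′ : ∀ {u₁ u₂ z} → arc D u₂ u₁ ≡ false → u₁ ≢ u₂ →
    3 ≤ outdeg D u₁ → 3 ≤ outdeg D u₂ → arc D u₁ z ≡ true → arc D u₂ z ≡ true → HasP4 D
  common-out-neighbour⇒HasP4′ {u₁} {u₂} {z} ¬u₂→u₁ u₁≢u₂ 3≤u₁ 3≤u₂ u₁→z u₂→z
    with ∃-avoiding₂ 3≤u₁ z u₂
  ... | x , u₁→x , x≢z , x≢u₂ with ∃-avoiding₂ 3≤u₂ z x
  ... | w , u₂→w , w≢z , w≢x =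
    mkHasP4
      ((≢-sym (arc⇒≢ u₁→x) ∷ x≢z ∷ x≢u₂ ∷ ≢-sym w≢x ∷ []) ∷
       (arc⇒≢ u₁→z ∷ u₁≢u₂ ∷ u₁≢w ∷ []) ∷
       (≢-sym (arc⇒≢ u₂→z) ∷ ≢-sym w≢z ∷ []) ∷
       (arc⇒≢ u₂→w ∷ []) ∷ [] ∷ [])
      u₁→x u₁→z u₂→z u₂→w
    where
    u₁≢w : u₁ ≢ w
    u₁≢w refl with () ← trans (sym u₂→w) ¬u₂→u₁

  common-out-neighbour⇒HasP4 : ∀ {u₁ u₂ z} → u₁ ≢ u₂ →
    3 ≤ outdeg D u₁ → 3 ≤ outdeg D u₂ → arc D u₁ z ≡ true → arc D u₂ z ≡ true → HasP4 D
  common-out-neighbour⇒HasP4 {u₁} {u₂} u₁≢u₂ 3≤u₁ 3≤u₂ u₁→z u₂→z with arc D u₂ u₁ in u₂u₁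
  ... | false = common-out-neighbour⇒HasP4′ u₂u₁ u₁≢u₂ 3≤u₁ 3≤u₂ u₁→z u₂→z
  ... | true  = common-out-neighbour⇒HasP4′ (asym D u₂ u₁ u₂u₁) (≢-sym u₁≢u₂) 3≤u₂ 3≤u₁ u₂→z u₁→z

  soutdeg≤outdeg : (S : Subdigraph D) → ∀ u → soutdeg S u ≤ outdeg D u
  soutdeg≤outdeg S u = count-mono λ x u→x → proj₁ (sub S u x u→x)

  inDo⇒3≤outdeg : (S : Subdigraph D) → ∀ {u} → inDo S u ≡ true → 3 ≤ outdeg D u
  inDo⇒3≤outdeg S {u} u∈Dᵒ =
    ≤-trans (≤ᵇ⇒≤ 3 (soutdeg S u) (Equivalence.from T-≡ (∧-conicalʳ (inV S u) _ u∈Dᵒ)))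
            (soutdeg≤outdeg S u)

  ¬HasP4⇒inNbrsInDo≤1 : ¬ HasP4 D → (S : Subdigraph D) → ∀ v → inNbrsInDo S v ≤ 1
  ¬HasP4⇒inNbrsInDo≤1 ¬p4 S v with inNbrsInDo S v ≤? 1
  ... | yes ≤1 = ≤1
  ... | no ≰1 with ∃-distinct-pair (≰⇒> ≰1)
  ... | u₁ , u₂ , u₁≢u₂ , u₁∈ , u₂∈ =
    ⊥-elim (¬p4 (common-out-neighbour⇒HasP4 u₁≢u₂
      (inDo⇒3≤outdeg S (∧-conicalˡ _ (arc D u₁ v) u₁∈))
      (inDo⇒3≤outdeg S (∧-conicalˡ _ (arc D u₂ v) u₂∈))
      (∧-conicalʳ (inDo S u₁) _ u₁∈)
      (∧-conicalʳ (inDo S u₂) _ u₂∈)))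

lemma2p8 : (n : ℕ) (D : Digraph n) →
    Connected D → ChiEq5 D → ¬ IsoT5 D →
    (∀ x → 2 ≤ outdeg D x) →
    ¬ HasP4 D → ¬ HasK5 D →
    (D' : Subdigraph D) → Critical5 D' →
    ∀ v → inNbrsInDo D' v ≤ 1
lemma2p8 n D _ _ _ _ ¬p4 _ D' _ = ¬HasP4⇒inNbrsInDo≤1 D ¬p4 D'
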